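{- Let $t\ge1$ and let $G=G_1\nabla^t G_2$ be a Haj\'os $t$-join of two disjoint non-empty graphs $G_1$ and $G_2$. Then $\chi_t(G)\ge\min\{\chi_t(G_1),\chi_t(G_2)\}$.
   Context: All graphs are finite, undirected, loopless, and may have multiple edges. Hajós $\ell$-join: let $G_1,G_2$ be disjoint graphs and for $i\in\{1,2\}$ let $u_i,v_i$ be distinct vertices of $G_i$ and $E_i$ a set of $\ell$ edges of $G_i$ joining $u_i$ and $v_i$. The graph $G_1\nabla^\ell G_2$ is obtained from $G_1\cup G_2$ by deleting $E_1$ and $E_2$, identifying $v_1$ with $v_2$, and adding $\ell$ new parallel edges between $u_1$ and $u_2$. A graph is strictly $t$-degenerate if every non-empty subgraph $H$ has a vertex of degree (with multiplicity) at most $t-1$ in $H$. $\chi_t(G)$ is the least $k\ge0$ such that $V(G)$ can be colored with $k$ colors so that each color class induces a strictly $t$-degenerate subgraph. -}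

module Defs where

open import Data.Nat using (ℕ; suc; _+_; _∸_; _≤_; _<_; _⊓_)
open import Data.Fin using (Fin; splitAt; punchIn; _≟_)
open import Data.Bool using (Bool; true; false; if_then_else_; _∧_; _∨_)
open import Data.Sum using (_⊎_; inj₁; inj₂)
open import Data.Product using (Σ; ∃; _×_)
open import Data.List using (map; allFin)
open import Data.Nat.ListAction using (sum)
open import Relation.Nullary.Decidable using (⌊_⌋)
open import Relation.Nullary using (¬_)
open import Relation.Binary.PropositionalEquality using (_≡_; _≢_)

Graph : ℕ → Set
Graph n = Fin n → Fin n → ℕ

IsMultigraph : ∀ {n} → Graph n → Set
IsMultigraph {n} m = (∀ x y → m x y ≡ m y x) × (∀ x → m x x ≡ 0)

deg : ∀ {n} → Graph n → Fin n → ℕ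
deg {n} h x = sum (map (h x) (allFin n))

record SubgraphWithin {n} (G : Graph n) (P : Fin n → Set) : Set₁ where
  field
    S      : Fin n → Set
    h      : Graph n
    S⊆P    : ∀ x → S x → P x
    h-sym  : ∀ x y → h x y ≡ h y x
    h≤G    : ∀ x y → h x y ≤ G x y
    h-in-S : ∀ x y → h x y ≢ 0 → S x × S y

StrictlyDegenerateOn : ∀ {n} → ℕ → Graph n → (Fin n → Set) → Set₁
StrictlyDegenerateOn t G P =
  (H : SubgraphWithin G P) → let open SubgraphWithin H in
  (∃ λ x → S x) → ∃ λ x → S x × deg h x < t

Colourable : ∀ {n} → ℕ → Graph n → ℕ → Set₁
Colourable {n} t G k =
  Σ (Fin n → Fin k) λ c → ∀ (i : Fin k) → StrictlyDegenerateOn t G (λ x → c x ≡ i)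

IsChiT : ∀ {n} → ℕ → Graph n → ℕ → Set₁
IsChiT t G k = Colourable t G k × (∀ j → Colourable t G j → k ≤ j)

_==_ : ∀ {n} → Fin n → Fin n → Bool
x == y = ⌊ x ≟ y ⌋

-- Vertex set: Fin n1 ⊎ (vertices of G2 other than v2, i.e. punchIn v2 '' Fin n2'),
-- encoded as Fin (n1 + n2'); v2 is identified with v1.
-- (Assumes G1 u1 v1 ≥ ℓ and G2 u2 v2 ≥ ℓ so that ∸ removes exactly ℓ edges.)
hajosJoin : ∀ {n1 n2'} (ℓ : ℕ) (G1 : Graph n1) (u1 v1 : Fin n1)
            (G2 : Graph (suc n2')) (u2 v2 : Fin (suc n2')) → Graph (n1 + n2')
hajosJoin {n1} {n2'} ℓ G1 u1 v1 G2 u2 v2 x y = jm (splitAt n1 x) (splitAt n1 y)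
  where
  G1' : Graph n1
  G1' a b = G1 a b ∸ (if (a == u1 ∧ b == v1) ∨ (a == v1 ∧ b == u1) then ℓ else 0)
  G2' : Graph (suc n2')
  G2' a b = G2 a b ∸ (if (a == u2 ∧ b == v2) ∨ (a == v2 ∧ b == u2) then ℓ else 0)
  e2 : Fin n2' → Fin (suc n2')
  e2 = punchIn v2
  cross : Fin n1 → Fin n2' → ℕ
  cross a b = (if a == v1 then G2' v2 (e2 b) else 0)
            + (if a == u1 ∧ e2 b == u2 then ℓ else 0)
  jm : Fin n1 ⊎ Fin n2' → Fin n1 ⊎ Fin n2' → ℕ
  jm (inj₁ a) (inj₁ b) = G1' a b
  jm (inj₂ a) (inj₂ b) = G2' (e2 a) (e2 b)
  jm (inj₁ a) (inj₂ b) = cross a b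
  jm (inj₂ a) (inj₁ b) = cross b a

-- Let c be a colouring of the join G witnessing χ_t(G). If c separates u₁ and v₁, then
-- every monochromatic subgraph of G₁ avoids the deleted u₁v₁-edges, so it is (isomorphic
-- to) a subgraph of G, and c restricted to G₁ is a colouring of G₁. The same holds for G₂,
-- whose vertex v₂ is identified with v₁, if c separates u₂ and v₂. Otherwise u₁, v₁ = v₂
-- and u₂ all get one colour, and the t new parallel edges u₁u₂ form a subgraph of that
-- colour class in which both vertices have degree t.
module Submission where

open import Defs
open import Algebra.Bundles using (CommutativeMonoid)
open import Data.Bool using (if_then_else_; _∧_; _∨_)
open import Data.Bool.Properties using (∧-comm; ∨-comm)
open import Data.Empty using (⊥-elim)
open import Data.Fin using (Fin; zero; suc; punchIn; punchOut; _≟_; _↑ˡ_; _↑ʳ_; splitAt)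
open import Data.Fin.Patterns using (0F; 1F)
open import Data.Fin.Properties
  using (any?; suc-injective; 0≢1+n; ↑ˡ-injective; ↑ʳ-injective; splitAt-↑ˡ; splitAt-↑ʳ;
         punchInᵢ≢i; punchIn-punchOut; punchOut-punchIn; punchOut-cong; punchOut-injective)
open import Data.List using (tabulate)
open import Data.List.Properties using (map-tabulate)
import Data.Nat.ListAction as List
open import Data.Nat using (ℕ; suc; _+_; _∸_; _≤_; _<_; _⊓_; z≤n)
import Data.Nat as ℕ
open import Data.Nat.Properties
  using (+-0-commutativeMonoid; ≤-refl; ≤-reflexive; ≤-trans; m≤m+n; m≤n+m; m+n≮m; 0∸n≡0; m⊓n≤m; m⊓n≤n)
open import Data.Product using (∃; _×_; _,_; proj₁; proj₂)
open import Data.Sum using (_⊎_; inj₁; inj₂)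
open import Data.Unit using (⊤; tt)
open import Function using (_∘_; id; Injective)
open import Relation.Nullary using (¬_; Dec; yes; no)
open import Relation.Binary.PropositionalEquality
  using (_≡_; _≢_; refl; sym; trans; cong; cong₂; subst; subst₂; module ≡-Reasoning)

module _ {c ℓ} (M : CommutativeMonoid c ℓ) where
  open CommutativeMonoid M using (Carrier; _≈_; ε; _∙_; ∙-congˡ; setoid) renaming (trans to ≈-trans)
  open import Algebra.Properties.CommutativeMonoid.Sum M
    using (sum; sum-remove; sum-cong-≋; sum-cong-≗; sum-replicate-zero)
  open import Relation.Binary.Reasoning.Setoid setoid

  sum-injective : ∀ {m n} (f : Fin m → Fin n) → Injective _≡_ _≡_ f → (g : Fin n → Carrier) →
                  (∀ y → (∀ x → f x ≢ y) → g y ≈ ε) → sum g ≈ sum (g ∘ f)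
  sum-injective {ℕ.zero} {n} f _ g g-off =
    ≈-trans (sum-cong-≋ (λ y → g-off y (λ ()))) (sum-replicate-zero n)
  sum-injective {suc m} {ℕ.zero} f _ _ _ with () ← f zero
  sum-injective {suc m} {suc n} f f-inj g g-off = begin
    sum g                             ≈⟨ sum-remove {i = p} g ⟩
    g p ∙ sum (g ∘ punchIn p)         ≈⟨ ∙-congˡ (sum-injective f′ f′-inj (g ∘ punchIn p) off′) ⟩
    g p ∙ sum (g ∘ punchIn p ∘ f′)    ≡⟨ cong (g p ∙_) (sum-cong-≗ (cong g ∘ punchIn-punchOut ∘ p≢f∘suc)) ⟩
    sum (g ∘ f)                       ∎
    where
    p : Fin (suc n)
    p = f zero
    p≢f∘suc : ∀ x → p ≢ f (suc x)
    p≢f∘suc x = 0≢1+n ∘ f-inj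
    f′ : Fin m → Fin n
    f′ x = punchOut (p≢f∘suc x)
    f′-inj : Injective _≡_ _≡_ f′
    f′-inj e = suc-injective (f-inj (punchOut-injective (p≢f∘suc _) (p≢f∘suc _) e))
    off′ : ∀ y → (∀ x → f′ x ≢ y) → g (punchIn p y) ≈ ε
    off′ y y∉f′ = g-off (punchIn p y) λ
      { zero    e → punchInᵢ≢i p y (sym e)
      ; (suc x) e → y∉f′ x (trans (punchOut-cong p e) (punchOut-punchIn p)) }

open import Algebra.Properties.CommutativeMonoid.Sum +-0-commutativeMonoid using (sum; sum-cong-≗)

sum-tabulate : ∀ {n} (g : Fin n → ℕ) → List.sum (tabulate g) ≡ sum g
sum-tabulate {ℕ.zero} g = refl
sum-tabulate {suc n}  g = cong (g zero +_) (sum-tabulate (g ∘ suc))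

deg≡sum : ∀ {n} (h : Graph n) x → deg h x ≡ sum (h x)
deg≡sum h x = trans (cong List.sum (map-tabulate id (h x))) (sum-tabulate (h x))

module Pushforward {m n} (f : Fin m → Fin n) (f-inj : Injective _≡_ _≡_ f) where

  preimage? : ∀ y → Dec (∃ λ x → f x ≡ y)
  preimage? y = any? (λ x → f x ≟ y)

  push : Graph m → Graph n
  push h y z with preimage? y | preimage? z
  ... | yes (a , _) | yes (b , _) = h a b
  ... | _           | _           = 0

  push-image : ∀ h a b → push h (f a) (f b) ≡ h a b
  push-image h a b with preimage? (f a) | preimage? (f b)
  ... | yes (a′ , e) | yes (b′ , e′) = cong₂ h (f-inj e) (f-inj e′)
  ... | no ∉         | _             = ⊥-elim (∉ (a , refl))
  ... | yes _        | no ∉          = ⊥-elim (∉ (b , refl))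

  push-outside : ∀ h y z → (∀ x → f x ≢ z) → push h y z ≡ 0
  push-outside h y z z∉ with preimage? y | preimage? z
  ... | yes _ | yes (b , e) = ⊥-elim (z∉ b e)
  ... | yes _ | no _        = refl
  ... | no _  | _           = refl

  push-sym : ∀ {h} → (∀ a b → h a b ≡ h b a) → ∀ y z → push h y z ≡ push h z y
  push-sym h-sym y z with preimage? y | preimage? z
  ... | yes (a , _) | yes (b , _) = h-sym a b
  ... | yes _       | no _        = refl
  ... | no _        | yes _       = refl
  ... | no _        | no _        = refl

  deg-push : ∀ h a → deg (push h) (f a) ≡ deg h a
  deg-push h a = begin
    deg (push h) (f a)      ≡⟨ deg≡sum (push h) (f a) ⟩
    sum (push h (f a))      ≡⟨ sum-injective +-0-commutativeMonoid f f-inj _ (push-outside h (f a)) ⟩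
    sum (push h (f a) ∘ f)  ≡⟨ sum-cong-≗ (push-image h a) ⟩
    sum (h a)               ≡⟨ sym (deg≡sum h a) ⟩
    deg h a                 ∎
    where open ≡-Reasoning

module _ {m n} {G : Graph m} {J : Graph n} {P : Fin n → Set} {Q : Fin m → Set}
         (f : Fin m → Fin n) (f-inj : Injective _≡_ _≡_ f) (Q⇒P : ∀ a → Q a → P (f a))
         (dominated : ∀ a b → Q a → Q b → G a b ≤ J (f a) (f b)) where

  open Pushforward f f-inj

  pushSubgraph : SubgraphWithin G Q → SubgraphWithin J P
  pushSubgraph H = record
    { S      = λ y → ∃ λ a → f a ≡ y × S a
    ; h      = push h
    ; S⊆P    = λ { _ (a , refl , Sa) → Q⇒P a (S⊆P a Sa) }
    ; h-sym  = push-sym h-sym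
    ; h≤G    = push≤J
    ; h-in-S = push-in-S
    }
    where
    open SubgraphWithin H

    h≤J : ∀ a b → h a b ≤ J (f a) (f b)
    h≤J a b with h a b ℕ.≟ 0
    ... | yes h≡0 = subst (_≤ J (f a) (f b)) (sym h≡0) z≤n
    ... | no h≢0  = let Sa , Sb = h-in-S a b h≢0 in
                    ≤-trans (h≤G a b) (dominated a b (S⊆P a Sa) (S⊆P b Sb))

    push≤J : ∀ y z → push h y z ≤ J y z
    push≤J y z with preimage? y | preimage? z
    ... | yes (a , refl) | yes (b , refl) = h≤J a b
    ... | yes _          | no _           = z≤n
    ... | no _           | _              = z≤n

    push-in-S : ∀ y z → push h y z ≢ 0 → (∃ λ a → f a ≡ y × S a) × (∃ λ b → f b ≡ z × S b)
    push-in-S y z push≢0 with preimage? y | preimage? z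
    ... | yes (a , fa≡y) | yes (b , fb≡z) = let Sa , Sb = h-in-S a b push≢0 in
                                            (a , fa≡y , Sa) , (b , fb≡z , Sb)
    ... | yes _          | no _           = ⊥-elim (push≢0 refl)
    ... | no _           | _              = ⊥-elim (push≢0 refl)

  strictlyDegenerateOn-pullback : ∀ {t} → StrictlyDegenerateOn t J P → StrictlyDegenerateOn t G Q
  strictlyDegenerateOn-pullback {t} J-degenerate H (x , Sx)
    with J-degenerate (pushSubgraph H) (f x , x , refl , Sx)
  ... | _ , (a , refl , Sa) , deg<t = a , Sa , subst (_< t) (deg-push (SubgraphWithin.h H) a) deg<t

colourable-pullback : ∀ {m n t k} {G : Graph m} {J : Graph n}
  (f : Fin m → Fin n) → Injective _≡_ _≡_ f →
  (c : Fin n → Fin k) → (∀ i → StrictlyDegenerateOn t J (λ y → c y ≡ i)) →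
  (∀ a b → c (f a) ≡ c (f b) → G a b ≤ J (f a) (f b)) → Colourable t G k
colourable-pullback f f-inj c classes-degenerate dominated =
  c ∘ f , λ i → strictlyDegenerateOn-pullback f f-inj (λ _ → id)
                  (λ a b ca cb → dominated a b (trans ca (sym cb))) (classes-degenerate i)

dipole : ℕ → Graph 2
dipole t 0F 1F = t
dipole t 1F 0F = t
dipole t _  _  = 0

dipole-not-degenerate : ∀ t → ¬ StrictlyDegenerateOn t (dipole t) (λ _ → ⊤)
dipole-not-degenerate t degenerate with degenerate whole (0F , tt)
  where
  whole : SubgraphWithin (dipole t) (λ _ → ⊤)
  whole = record
    { S      = λ _ → ⊤
    ; h      = dipole t
    ; S⊆P    = λ _ _ → tt
    ; h-sym  = λ { 0F 0F → refl ; 0F 1F → refl ; 1F 0F → refl ; 1F 1F → refl }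
    ; h≤G    = λ _ _ → ≤-refl
    ; h-in-S = λ _ _ _ → tt , tt
    }
... | 0F , _ , deg<t = m+n≮m t 0 deg<t
... | 1F , _ , deg<t = m+n≮m t 0 deg<t

parallelEdges-not-degenerate : ∀ {n t} {J : Graph n} {P : Fin n → Set} {x y} → x ≢ y → P x → P y →
                               t ≤ J x y → t ≤ J y x → ¬ StrictlyDegenerateOn t J P
parallelEdges-not-degenerate {n} {t} {J} {P} {x} {y} x≢y Px Py t≤Jxy t≤Jyx J-degenerate =
  dipole-not-degenerate t (strictlyDegenerateOn-pullback ends ends-inj ends-in-P dominated J-degenerate)
  where
  ends : Fin 2 → Fin n
  ends 0F = x
  ends 1F = y
  ends-inj : Injective _≡_ _≡_ ends
  ends-inj {0F} {0F} _ = refl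
  ends-inj {0F} {1F} e = ⊥-elim (x≢y e)
  ends-inj {1F} {0F} e = ⊥-elim (x≢y (sym e))
  ends-inj {1F} {1F} _ = refl
  ends-in-P : ∀ a → ⊤ → P (ends a)
  ends-in-P 0F _ = Px
  ends-in-P 1F _ = Py
  dominated : ∀ a b → ⊤ → ⊤ → dipole t a b ≤ J (ends a) (ends b)
  dominated 0F 0F _ _ = z≤n
  dominated 0F 1F _ _ = t≤Jxy
  dominated 1F 0F _ _ = t≤Jyx
  dominated 1F 1F _ _ = z≤n

-- Literally the deletion performed inside hajosJoin, so that the two agree definitionally.
deleteEdges : ∀ {n} → ℕ → Graph n → Fin n → Fin n → Graph n
deleteEdges ℓ G u v a b = G a b ∸ (if (a == u ∧ b == v) ∨ (a == v ∧ b == u) then ℓ else 0)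

deleteEdges-agree : ∀ {n ℓ} {C : Set} (G : Graph n) (u v : Fin n) (k : Fin n → C) → k u ≢ k v →
                    ∀ {a b} → k a ≡ k b → deleteEdges ℓ G u v a b ≡ G a b
deleteEdges-agree G u v k ku≢kv {a} {b} ka≡kb with a ≟ u | b ≟ v | a ≟ v | b ≟ u
... | yes refl | yes refl | _        | _        = ⊥-elim (ku≢kv ka≡kb)
... | _        | _        | yes refl | yes refl = ⊥-elim (ku≢kv (sym ka≡kb))
... | no _     | _        | no _     | _        = refl
... | no _     | _        | yes _    | no _     = refl
... | yes _    | no _     | no _     | _        = refl
... | yes _    | no _     | yes _    | no _     = refl

deleteEdges-isMultigraph : ∀ {n ℓ} {G : Graph n} {u v} → IsMultigraph G → IsMultigraph (deleteEdges ℓ G u v)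
deleteEdges-isMultigraph {ℓ = ℓ} {G} {u} {v} (G-sym , G-loopless) = D-sym , D-loopless
  where
  D-sym : ∀ a b → deleteEdges ℓ G u v a b ≡ deleteEdges ℓ G u v b a
  D-sym a b = cong₂ _∸_ (G-sym a b) (cong (if_then ℓ else 0)
    (trans (cong₂ _∨_ (∧-comm (a == u) (b == v)) (∧-comm (a == v) (b == u)))
           (∨-comm (b == v ∧ a == u) (b == u ∧ a == v))))
  D-loopless : ∀ a → deleteEdges ℓ G u v a a ≡ 0
  D-loopless a rewrite G-loopless a = 0∸n≡0 (if (a == u ∧ a == v) ∨ (a == v ∧ a == u) then ℓ else 0)

data Punched {n} (v : Fin (suc n)) : Fin (suc n) → Set where
  here  : Punched v v
  there : ∀ b → Punched v (punchIn v b)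

punched : ∀ {n} (v b : Fin (suc n)) → Punched v b
punched zero    zero    = here
punched zero    (suc b) = there b
punched {suc n} (suc v) zero = there zero
punched {suc n} (suc v) (suc b) with punched v b
... | here     = here
... | there b′ = there (suc b′)

module HajósJoin {n₁ n₂} (ℓ : ℕ) (G₁ : Graph n₁) (u₁ v₁ : Fin n₁)
                 (G₂ : Graph (suc n₂)) (u₂ v₂ : Fin (suc n₂)) where

  J : Graph (n₁ + n₂)
  J = hajosJoin ℓ G₁ u₁ v₁ G₂ u₂ v₂

  ι₁ : Fin n₁ → Fin (n₁ + n₂)
  ι₁ a = a ↑ˡ n₂

  ι₂ : Fin (suc n₂) → Fin (n₁ + n₂)
  ι₂ b with punched v₂ b
  ... | here     = ι₁ v₁
  ... | there b′ = n₁ ↑ʳ b′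

  ι₁-injective : Injective _≡_ _≡_ ι₁
  ι₁-injective = ↑ˡ-injective n₂ _ _

  ι₁≢↑ʳ : ∀ a b → ι₁ a ≢ n₁ ↑ʳ b
  ι₁≢↑ʳ a b e with () ← trans (sym (splitAt-↑ˡ n₁ a n₂)) (trans (cong (splitAt n₁) e) (splitAt-↑ʳ n₁ n₂ b))

  ι₂-injective : Injective _≡_ _≡_ ι₂
  ι₂-injective {a} {b} e with punched v₂ a | punched v₂ b
  ... | here     | here     = refl
  ... | here     | there b′ = ⊥-elim (ι₁≢↑ʳ v₁ b′ e)
  ... | there a′ | here     = ⊥-elim (ι₁≢↑ʳ v₁ a′ (sym e))
  ... | there a′ | there b′ = cong (punchIn v₂) (↑ʳ-injective n₁ a′ b′ e)

  ι₂-glued : ∀ {b} → b ≡ v₂ → ι₂ b ≡ ι₁ v₁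
  ι₂-glued {b} b≡v₂ with punched v₂ b
  ... | here     = refl
  ... | there b′ = ⊥-elim (punchInᵢ≢i v₂ b′ b≡v₂)

  ι₁≢ι₂ : ∀ a {b} → b ≢ v₂ → ι₁ a ≢ ι₂ b
  ι₁≢ι₂ a {b} b≢v₂ with punched v₂ b
  ... | here     = ⊥-elim (b≢v₂ refl)
  ... | there b′ = ι₁≢↑ʳ a b′

  J-ι₁ : ∀ a b → J (ι₁ a) (ι₁ b) ≡ deleteEdges ℓ G₁ u₁ v₁ a b
  J-ι₁ a b rewrite splitAt-↑ˡ n₁ a n₂ | splitAt-↑ˡ n₁ b n₂ = refl

  J-↑ʳ : ∀ a b → J (n₁ ↑ʳ a) (n₁ ↑ʳ b) ≡ deleteEdges ℓ G₂ u₂ v₂ (punchIn v₂ a) (punchIn v₂ b)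
  J-↑ʳ a b rewrite splitAt-↑ʳ n₁ n₂ a | splitAt-↑ʳ n₁ n₂ b = refl

  J-cross : ∀ a b → J (ι₁ a) (n₁ ↑ʳ b) ≡ (if a == v₁ then deleteEdges ℓ G₂ u₂ v₂ v₂ (punchIn v₂ b) else 0)
                                         + (if a == u₁ ∧ punchIn v₂ b == u₂ then ℓ else 0)
  J-cross a b rewrite splitAt-↑ˡ n₁ a n₂ | splitAt-↑ʳ n₁ n₂ b = refl

  J-cross-sym : ∀ a b → J (n₁ ↑ʳ b) (ι₁ a) ≡ J (ι₁ a) (n₁ ↑ʳ b)
  J-cross-sym a b rewrite splitAt-↑ˡ n₁ a n₂ | splitAt-↑ʳ n₁ n₂ b = refl

  ι₁-dominated : ∀ {C : Set} (k : Fin (n₁ + n₂) → C) → k (ι₁ u₁) ≢ k (ι₁ v₁) →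
                 ∀ a b → k (ι₁ a) ≡ k (ι₁ b) → G₁ a b ≤ J (ι₁ a) (ι₁ b)
  ι₁-dominated k separated a b agree =
    ≤-reflexive (sym (trans (J-ι₁ a b) (deleteEdges-agree G₁ u₁ v₁ (k ∘ ι₁) separated agree)))

  deleteEdges-v₂≤J : ∀ b → deleteEdges ℓ G₂ u₂ v₂ v₂ (punchIn v₂ b) ≤ J (ι₁ v₁) (n₁ ↑ʳ b)
  deleteEdges-v₂≤J b rewrite J-cross v₁ b with v₁ ≟ v₁
  ... | yes _    = m≤m+n _ _
  ... | no v₁≢v₁ = ⊥-elim (v₁≢v₁ refl)

  deleteEdges≤J : IsMultigraph (deleteEdges ℓ G₂ u₂ v₂) →
                  ∀ a b → deleteEdges ℓ G₂ u₂ v₂ a b ≤ J (ι₂ a) (ι₂ b)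
  deleteEdges≤J (D-sym , D-loopless) a b with punched v₂ a | punched v₂ b
  ... | here     | here     = ≤-trans (≤-reflexive (D-loopless a)) z≤n
  ... | here     | there b′ = deleteEdges-v₂≤J b′
  ... | there a′ | here     = subst₂ _≤_ (D-sym v₂ (punchIn v₂ a′)) (sym (J-cross-sym v₁ a′)) (deleteEdges-v₂≤J a′)
  ... | there a′ | there b′ = ≤-reflexive (sym (J-↑ʳ a′ b′))

  ι₂-dominated : IsMultigraph G₂ → ∀ {C : Set} (k : Fin (n₁ + n₂) → C) → k (ι₂ u₂) ≢ k (ι₂ v₂) →
                 ∀ a b → k (ι₂ a) ≡ k (ι₂ b) → G₂ a b ≤ J (ι₂ a) (ι₂ b)
  ι₂-dominated G₂-multi k separated a b agree =
    subst (_≤ J (ι₂ a) (ι₂ b)) (deleteEdges-agree G₂ u₂ v₂ (k ∘ ι₂) separated agree)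
          (deleteEdges≤J (deleteEdges-isMultigraph G₂-multi) a b)

  ℓ≤J-u₁u₂ : u₂ ≢ v₂ → ℓ ≤ J (ι₁ u₁) (ι₂ u₂) × ℓ ≤ J (ι₂ u₂) (ι₁ u₁)
  ℓ≤J-u₁u₂ u₂≢v₂ with punched v₂ u₂
  ... | here     = ⊥-elim (u₂≢v₂ refl)
  ... | there b′ = ℓ≤J , subst (ℓ ≤_) (sym (J-cross-sym u₁ b′)) ℓ≤J
    where
    ℓ≤J : ℓ ≤ J (ι₁ u₁) (n₁ ↑ʳ b′)
    ℓ≤J rewrite J-cross u₁ b′ with u₁ ≟ u₁ | punchIn v₂ b′ ≟ punchIn v₂ b′
    ... | yes _    | yes _ = m≤n+m ℓ _
    ... | no u₁≢u₁ | _     = ⊥-elim (u₁≢u₁ refl)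
    ... | yes _    | no ≢  = ⊥-elim (≢ refl)

  colourable⇒colourable₁⊎colourable₂ : ∀ {t k} → IsMultigraph G₂ → u₂ ≢ v₂ → t ≤ ℓ →
    Colourable t J k → Colourable t G₁ k ⊎ Colourable t G₂ k
  colourable⇒colourable₁⊎colourable₂ G₂-multi u₂≢v₂ t≤ℓ (c , classes-degenerate)
    with c (ι₁ u₁) ≟ c (ι₁ v₁) | c (ι₂ u₂) ≟ c (ι₂ v₂)
  ... | no separated | _ =
    inj₁ (colourable-pullback ι₁ ι₁-injective c classes-degenerate (ι₁-dominated c separated))
  ... | yes _ | no separated =
    inj₂ (colourable-pullback ι₂ ι₂-injective c classes-degenerate (ι₂-dominated G₂-multi c separated))
  ... | yes u₁~v₁ | yes u₂~v₂ =
    ⊥-elim (parallelEdges-not-degenerate (ι₁≢ι₂ u₁ u₂≢v₂) refl u₂~u₁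
              (≤-trans t≤ℓ (proj₁ (ℓ≤J-u₁u₂ u₂≢v₂))) (≤-trans t≤ℓ (proj₂ (ℓ≤J-u₁u₂ u₂≢v₂)))
              (classes-degenerate (c (ι₁ u₁))))
    where
    u₂~u₁ : c (ι₂ u₂) ≡ c (ι₁ u₁)
    u₂~u₁ = trans u₂~v₂ (trans (cong c (ι₂-glued refl)) (sym u₁~v₁))

-- The hypotheses t ≤ G_i u_i v_i only ensure that hajosJoin deletes exactly t edges;
-- the argument does not need them, nor 1 ≤ t, u1 ≢ v1 or that G1 is a multigraph.
proposition12 : (t : ℕ) → 1 ≤ t →
    ∀ {n1 n2'} (G1 : Graph n1) (G2 : Graph (suc n2'))
      (u1 v1 : Fin n1) (u2 v2 : Fin (suc n2')) →
    IsMultigraph G1 → IsMultigraph G2 →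
    u1 ≢ v1 → u2 ≢ v2 → t ≤ G1 u1 v1 → t ≤ G2 u2 v2 →
    ∀ (χ χ1 χ2 : ℕ) →
    IsChiT t (hajosJoin t G1 u1 v1 G2 u2 v2) χ →
    IsChiT t G1 χ1 → IsChiT t G2 χ2 →
    χ1 ⊓ χ2 ≤ χ
proposition12 t _ G1 G2 u1 v1 u2 v2 _ G2-multi _ u2≢v2 _ _ χ χ1 χ2 (J-colourable , _) (_ , χ1-least) (_ , χ2-least)
  with HajósJoin.colourable⇒colourable₁⊎colourable₂ t G1 u1 v1 G2 u2 v2 G2-multi u2≢v2 ≤-refl J-colourable
... | inj₁ G1-colourable = ≤-trans (m⊓n≤m χ1 χ2) (χ1-least χ G1-colourable)
... | inj₂ G2-colourable = ≤-trans (m⊓n≤n χ1 χ2) (χ2-least χ G2-colourable)
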